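{- For every countable structure $\mathcal A$, $Co(\mathcal A)=\{\mathbf d:\mathbf d\le\mathbf a\text{ for all }\mathbf a\in eSp(\mathcal A)\}$.
   Context: Structures have universe $\omega$, countable relational language $(R_i)_i$; $P(\mathcal B)={=^{\mathcal B}}\oplus{\neq^{\mathcal B}}\oplus\bigoplus_iR_i^{\mathcal B}$; degrees are enumeration degrees. $Co(\mathcal A)=\bigcap_{\mathcal B\cong\mathcal A}\{\mathbf d:\mathbf d\le\deg_e(P(\mathcal B))\}$, the intersection over presentations $\mathcal B$ with universe $\omega$ isomorphic to $\mathcal A$. For a surjection $f:\omega\to\omega$, $f^{ -1}(\mathcal A)$ is the structure on $\omega$ with relations $f^{ -1}(=),f^{ -1}(\neq),f^{ -1}(R_i^{\mathcal A})$ (where $f^{ -1}(X)=\{\langle x_1,\dots,x_n\rangle:(f(x_1),\dots,f(x_n))\in X\}$) and $P(f^{ -1}(\mathcal A))=f^{ -1}(=)\oplus f^{ -1}(\neq)\oplus\bigoplus_if^{ -1}(R_i^{\mathcal A})$. $eSp(\mathcal A)=\{\deg_e(P(f^{ -1}(\mathcal A))):f:\omega\to\omega\text{ surjective}\}$. -}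

module Defs where

open import Level using (0ℓ)
open import Data.Nat using (ℕ; zero; suc; _+_; _*_; _%_; _/_)
open import Data.Fin using (Fin; toℕ)
open import Data.Vec using (Vec; []; _∷_; map)
open import Data.Product using (Σ; _×_; _,_; ∃)
open import Data.Sum using (_⊎_)
open import Relation.Nullary using (¬_)
open import Relation.Binary.PropositionalEquality using (_≡_)
open import Function.Bundles using (_⇔_)

SetN : Set₁
SetN = ℕ → Set

tri : ℕ → ℕ
tri zero    = zero
tri (suc n) = suc n + tri n

pair : ℕ → ℕ → ℕ
pair a b = tri (a + b) + b

-- code of an n-tuple ⟨x₁,…,xₙ⟩ (injective for each fixed n)
code : {n : ℕ} → Vec ℕ n → ℕ
code []      = zero
code (x ∷ v) = pair x (code v)

bit : ℕ → ℕ → ℕ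
bit u zero    = u % 2
bit u (suc i) = bit (u / 2) i

D : ℕ → SetN
D u i = bit u i ≡ 1

_⊆_ : SetN → SetN → Set
A ⊆ B = ∀ i → A i → B i

data PR : ℕ → Set where
  zeroF : PR 0
  succF : PR 1
  projF : {n : ℕ} → Fin n → PR n
  compF : {m n : ℕ} → PR m → Vec (PR n) m → PR n
  recF  : {n : ℕ} → PR n → PR (suc (suc n)) → PR (suc n)

lookupV : {n : ℕ} → Vec ℕ n → Fin n → ℕ
lookupV (x ∷ v) Fin.zero    = x
lookupV (x ∷ v) (Fin.suc i) = lookupV v i

mutual
  eval : {n : ℕ} → PR n → Vec ℕ n → ℕ
  eval zeroF       v       = zero
  eval succF       (x ∷ []) = suc x
  eval (projF i)   v       = lookupV v i
  eval (compF g hs) v      = eval g (evalAll hs v)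
  eval (recF g h)  (zero ∷ v)  = eval g v
  eval (recF g h)  (suc k ∷ v) = eval h (k ∷ eval (recF g h) (k ∷ v) ∷ v)

  evalAll : {m n : ℕ} → Vec (PR n) m → Vec ℕ n → Vec ℕ m
  evalAll []       v = []
  evalAll (h ∷ hs) v = eval h v ∷ evalAll hs v

-- the c.e. set with Σ₁ (Kleene normal form) index g:
-- W_g = { c : ∃ m, g(c,m) = 0 }, g primitive recursive
W : PR 2 → SetN
W g c = ∃ λ m → eval g (c ∷ m ∷ []) ≡ 0

_≤e_ : SetN → SetN → Set
A ≤e B = Σ (PR 2) λ g → ∀ x → A x ⇔ (∃ λ u → W g (pair x u) × (D u ⊆ B))

_⊕_ : SetN → SetN → SetN
(A ⊕ B) n = (∃ λ x → n ≡ 2 * x × A x) ⊎ (∃ λ x → n ≡ suc (2 * x) × B x)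

data Language : Set where
  finLang : {k : ℕ} → (Fin k → ℕ) → Language
  infLang : (ℕ → ℕ) → Language

Idx : Language → Set
Idx (finLang {k} _) = Fin k
Idx (infLang _)     = ℕ

idxℕ : (L : Language) → Idx L → ℕ
idxℕ (finLang _) i = toℕ i
idxℕ (infLang _) i = i

arity : (L : Language) → Idx L → ℕ
arity (finLang ar) i = ar i
arity (infLang ar) i = ar i

tuples : {n : ℕ} → (Vec ℕ n → Set) → SetN
tuples {n} X c = Σ (Vec ℕ n) λ v → code v ≡ c × X v

bigJoin : (L : Language) → (Idx L → SetN) → SetN
bigJoin L X c = Σ (Idx L) λ i → Σ ℕ λ x → c ≡ pair (idxℕ L i) x × X i x

-- Structures with universe ω, and "presentations" (interpretations of
-- =, ≠ and the R_i by arbitrary relations on ω)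

record Structure (L : Language) : Set₁ where
  field
    rel : (i : Idx L) → Vec ℕ (arity L i) → Set
open Structure public

record Interp (L : Language) : Set₁ where
  field
    eqR  : Vec ℕ 2 → Set
    neqR : Vec ℕ 2 → Set
    relR : (i : Idx L) → Vec ℕ (arity L i) → Set
open Interp public

Pᵢ : {L : Language} → Interp L → SetN
Pᵢ {L} I = tuples (eqR I) ⊕ (tuples (neqR I) ⊕ bigJoin L (λ i → tuples (relR I i)))

EqV : Vec ℕ 2 → Set
EqV (x ∷ y ∷ []) = x ≡ y

NeqV : Vec ℕ 2 → Set
NeqV (x ∷ y ∷ []) = ¬ (x ≡ y)

asInterp : {L : Language} → Structure L → Interp L
asInterp 𝓑 = record { eqR = EqV ; neqR = NeqV ; relR = rel 𝓑 }

P : {L : Language} → Structure L → SetN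
P 𝓑 = Pᵢ (asInterp 𝓑)

preimage : {L : Language} → (ℕ → ℕ) → Structure L → Interp L
preimage f 𝓐 = record
  { eqR  = λ v → EqV (map f v)
  ; neqR = λ v → NeqV (map f v)
  ; relR = λ i v → rel 𝓐 i (map f v) }

Surjective : (ℕ → ℕ) → Set
Surjective f = ∀ y → ∃ λ x → f x ≡ y

Injective : (ℕ → ℕ) → Set
Injective f = ∀ x y → f x ≡ f y → x ≡ y

_≅_ : {L : Language} → Structure L → Structure L → Set
_≅_ {L} 𝓑 𝓐 = Σ (ℕ → ℕ) λ h → Injective h × Surjective h ×
               (∀ (i : Idx L) (v : Vec ℕ (arity L i)) → rel 𝓑 i v ⇔ rel 𝓐 i (map h v))

-- Co(𝓐) and the lower cone of eSp(𝓐), as predicates on sets X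
-- (deg_e(X) ∈ Co(𝓐) iff X ∈ Co 𝓐; both are closed under ≡e)

Co : {L : Language} → Structure L → SetN → Set₁
Co 𝓐 X = ∀ 𝓑 → 𝓑 ≅ 𝓐 → X ≤e P 𝓑

belowESp : {L : Language} → Structure L → SetN → Set
belowESp 𝓐 X = ∀ f → Surjective f → X ≤e Pᵢ (preimage f 𝓐)

{-# OPTIONS --safe #-}
-- If h : 𝓑 ≅ 𝓐, then P(𝓑) and P(h⁻¹(𝓐)) are the same set, so the lower cone of eSp(𝓐)
-- lies in Co(𝓐). Conversely, given a surjection f, let enum list the first occurrences of the
-- values of f in increasing order. Then f ∘ enum is a bijection, so 𝓑 = (f ∘ enum)⁻¹(𝓐) is a
-- presentation of 𝓐, and every finite subset of P(𝓑) is certified by a finite subset of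
-- P(f⁻¹(𝓐)): the (in)equalities f k = f j that determine enum on the entries involved, together
-- with the tuples of f⁻¹(𝓐) that correspond to the tuples in question. Checking a certificate is
-- primitive recursive, so X ≤e P(𝓑) composes with it to X ≤e P(f⁻¹(𝓐)); the checks are written
-- as arithmetic terms and compiled to PR codes.
module Submission where

open import Defs
open import Data.Nat using (ℕ; zero; suc; _+_; _*_; _∸_; pred; _≤_; _<_; z≤n; s≤s; _≤?_; _<?_; _≟_)
open import Data.Nat.Properties
open import Data.Fin using (Fin; zero; suc)
open import Data.Vec using (Vec; []; _∷_; tabulate; map)
open import Function.Bundles using (_⇔_; mk⇔; Equivalence)
open import Relation.Binary.PropositionalEquality
open import Relation.Nullary using (¬_; Dec; yes; no)
open import Relation.Nullary.Decidable using (¬?; _×-dec_; _⊎-dec_; decidable-stable)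
open import Relation.Unary using (Decidable)
open import Relation.Binary.Definitions using (tri<; tri≈; tri>)
open import Data.Product using (Σ; _×_; _,_; proj₁; proj₂; ∃)
open import Data.Sum using (_⊎_; inj₁; inj₂)
open import Data.Empty using (⊥-elim)
open import Data.Nat.Induction using (<-rec)
open import Data.Nat.DivMod using (_%_; _/_; m≡m%n+[m/n]*n; [m+kn]%n≡m%n; m<n⇒m%n≡m; m/n<m)
open import Data.Nat.GeneralisedArithmetic using (fold; iterate; iterate-is-fold)
open import Data.Vec.Properties using (map-∘)
open import Function.Base using (case_of_)
open Equivalence using (to; from)

module PrimitiveRecursive where

  constP : ∀ {n} → ℕ → PR n
  constP zero    = compF zeroF []
  constP (suc k) = compF succF (constP k ∷ [])

  constP-eval : ∀ {n} k (v : Vec ℕ n) → eval (constP k) v ≡ k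
  constP-eval zero    v = refl
  constP-eval (suc k) v = cong suc (constP-eval k v)

  π₀ : ∀ {n} → PR (suc n)
  π₀ = projF zero

  π₁ : ∀ {n} → PR (suc (suc n))
  π₁ = projF (suc zero)

  π₂ : ∀ {n} → PR (suc (suc (suc n)))
  π₂ = projF (suc (suc zero))

  addP : PR 2
  addP = recF π₀ (compF succF (π₁ ∷ []))

  addP-eval : ∀ x y → eval addP (x ∷ y ∷ []) ≡ x + y
  addP-eval zero    y = refl
  addP-eval (suc x) y = cong suc (addP-eval x y)

  predP : PR 1
  predP = recF zeroF π₀

  predP-eval : ∀ x → eval predP (x ∷ []) ≡ pred x
  predP-eval zero    = refl
  predP-eval (suc x) = refl

  -- the recursion runs on the subtrahend, so the arguments are swapped
  monusP : PR 2
  monusP = recF π₀ (compF predP (π₁ ∷ []))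

  monusP-eval : ∀ y x → eval monusP (y ∷ x ∷ []) ≡ x ∸ y
  monusP-eval zero    x = refl
  monusP-eval (suc y) x
    rewrite predP-eval (eval monusP (y ∷ x ∷ [])) | monusP-eval y x = pred[m∸n]≡m∸[1+n] x y

  mulP : PR 2
  mulP = recF (constP 0) (compF addP (π₁ ∷ π₂ ∷ []))

  mulP-eval : ∀ x y → eval mulP (x ∷ y ∷ []) ≡ x * y
  mulP-eval zero    y = refl
  mulP-eval (suc x) y
    rewrite addP-eval (eval mulP (x ∷ y ∷ [])) y | mulP-eval x y = +-comm (x * y) y

  infixl 6 _+ᴾ_ _∸ᴾ_
  infixl 7 _*ᴾ_

  _+ᴾ_ _∸ᴾ_ _*ᴾ_ : ∀ {n} → PR n → PR n → PR n
  p +ᴾ q = compF addP (p ∷ q ∷ [])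
  p ∸ᴾ q = compF monusP (q ∷ p ∷ [])
  p *ᴾ q = compF mulP (p ∷ q ∷ [])

  evalAll-projF : ∀ {n m} (ρ : Fin n → Fin m) (v : Vec ℕ m) →
    evalAll (tabulate (λ i → projF (ρ i))) v ≡ tabulate (λ i → lookupV v (ρ i))
  evalAll-projF {zero}  ρ v = refl
  evalAll-projF {suc n} ρ v = cong (lookupV v (ρ zero) ∷_) (evalAll-projF (λ i → ρ (suc i)) v)

  tabulate-lookupV : ∀ {n} (xs : Vec ℕ n) → tabulate (lookupV xs) ≡ xs
  tabulate-lookupV []       = refl
  tabulate-lookupV (x ∷ xs) = cong (x ∷_) (tabulate-lookupV xs)

  drop₂ : ∀ {n} → Vec (PR (suc (suc n))) n
  drop₂ = tabulate (λ i → projF (suc (suc i)))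

  drop₂-eval : ∀ {n} k a (xs : Vec ℕ n) → evalAll drop₂ (k ∷ a ∷ xs) ≡ xs
  drop₂-eval k a xs = trans (evalAll-projF (λ i → suc (suc i)) (k ∷ a ∷ xs)) (tabulate-lookupV xs)

  sumTo : ℕ → (ℕ → ℕ) → ℕ
  sumTo zero    F = 0
  sumTo (suc b) F = sumTo b F + F b

  prodTo : ℕ → (ℕ → ℕ) → ℕ
  prodTo zero    F = 1
  prodTo (suc b) F = prodTo b F * F b

  sumP : ∀ {n} → PR (suc n) → PR (suc n)
  sumP body = recF (constP 0) (π₁ +ᴾ compF body (π₀ ∷ drop₂))

  sumP-eval : ∀ {n} (body : PR (suc n)) b xs →
    eval (sumP body) (b ∷ xs) ≡ sumTo b (λ i → eval body (i ∷ xs))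
  sumP-eval body zero    xs = refl
  sumP-eval body (suc b) xs
    rewrite addP-eval (eval (sumP body) (b ∷ xs))
                      (eval body (b ∷ evalAll drop₂ (b ∷ eval (sumP body) (b ∷ xs) ∷ xs)))
          | drop₂-eval b (eval (sumP body) (b ∷ xs)) xs
          | sumP-eval body b xs = refl

  prodP : ∀ {n} → PR (suc n) → PR (suc n)
  prodP body = recF (constP 1) (π₁ *ᴾ compF body (π₀ ∷ drop₂))

  prodP-eval : ∀ {n} (body : PR (suc n)) b xs →
    eval (prodP body) (b ∷ xs) ≡ prodTo b (λ i → eval body (i ∷ xs))
  prodP-eval body zero    xs = constP-eval 1 xs
  prodP-eval body (suc b) xs
    rewrite mulP-eval (eval (prodP body) (b ∷ xs))
                      (eval body (b ∷ evalAll drop₂ (b ∷ eval (prodP body) (b ∷ xs) ∷ xs)))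
          | drop₂-eval b (eval (prodP body) (b ∷ xs)) xs
          | prodP-eval body b xs = refl

  sumTo-cong : ∀ b {F G : ℕ → ℕ} → (∀ i → i < b → F i ≡ G i) → sumTo b F ≡ sumTo b G
  sumTo-cong zero    e = refl
  sumTo-cong (suc b) e = cong₂ _+_ (sumTo-cong b (λ i i<b → e i (m<n⇒m<1+n i<b))) (e b ≤-refl)

  prodTo-cong : ∀ b {F G : ℕ → ℕ} → (∀ i → F i ≡ G i) → prodTo b F ≡ prodTo b G
  prodTo-cong zero    e = refl
  prodTo-cong (suc b) e = cong₂ _*_ (prodTo-cong b e) (e b)

  term≤sumTo : ∀ b F {i} → i < b → F i ≤ sumTo b F
  term≤sumTo (suc b) F {i} i<1+b with m≤n⇒m<n∨m≡n i<1+b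
  ... | inj₁ (s≤s i<b) = ≤-trans (term≤sumTo b F i<b) (m≤m+n (sumTo b F) (F b))
  ... | inj₂ refl      = m≤n+m (F i) (sumTo b F)

  sumTo-mono-≤ : ∀ F {m n} → m ≤ n → sumTo m F ≤ sumTo n F
  sumTo-mono-≤ F {m} {zero}  z≤n = ≤-refl
  sumTo-mono-≤ F {m} {suc n} m≤1+n with m≤n⇒m<n∨m≡n m≤1+n
  ... | inj₂ refl       = ≤-refl
  ... | inj₁ (s≤s m≤n) = ≤-trans (sumTo-mono-≤ F m≤n) (m≤m+n (sumTo n F) (F n))

module Terms where

  open PrimitiveRecursive

  data Term : ℕ → Set where
    var   : ∀ {n} → Fin n → Term n
    lit   : ∀ {n} → ℕ → Term n
    _+ᵗ_  : ∀ {n} → Term n → Term n → Term n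
    _∸ᵗ_  : ∀ {n} → Term n → Term n → Term n
    _*ᵗ_  : ∀ {n} → Term n → Term n → Term n
    app   : ∀ {m n} → Term m → Vec (Term n) m → Term n
    rec   : ∀ {n} → Term n → Term (suc (suc n)) → Term (suc n)
    sumᵗ  : ∀ {n} → Term (suc n) → Term (suc n)
    prodᵗ : ∀ {n} → Term (suc n) → Term (suc n)
    prim  : ∀ {n} → PR n → Term n

  mutual
    ⟦_⟧ : ∀ {n} → Term n → Vec ℕ n → ℕ
    ⟦ var i ⟧   v = lookupV v i
    ⟦ lit k ⟧   v = k
    ⟦ a +ᵗ b ⟧  v = ⟦ a ⟧ v + ⟦ b ⟧ v
    ⟦ a ∸ᵗ b ⟧  v = ⟦ a ⟧ v ∸ ⟦ b ⟧ v
    ⟦ a *ᵗ b ⟧  v = ⟦ a ⟧ v * ⟦ b ⟧ v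
    ⟦ app f ts ⟧ v = ⟦ f ⟧ (⟦ ts ⟧* v)
    ⟦ rec g h ⟧ (zero ∷ v)  = ⟦ g ⟧ v
    ⟦ rec g h ⟧ (suc k ∷ v) = ⟦ h ⟧ (k ∷ ⟦ rec g h ⟧ (k ∷ v) ∷ v)
    ⟦ sumᵗ t ⟧  (k ∷ v) = sumTo k (λ i → ⟦ t ⟧ (i ∷ v))
    ⟦ prodᵗ t ⟧ (k ∷ v) = prodTo k (λ i → ⟦ t ⟧ (i ∷ v))
    ⟦ prim p ⟧  v = eval p v

    ⟦_⟧* : ∀ {m n} → Vec (Term n) m → Vec ℕ n → Vec ℕ m
    ⟦ [] ⟧*     v = []
    ⟦ t ∷ ts ⟧* v = ⟦ t ⟧ v ∷ ⟦ ts ⟧* v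

  mutual
    compile : ∀ {n} → Term n → PR n
    compile (var i)    = projF i
    compile (lit k)    = constP k
    compile (a +ᵗ b)   = compile a +ᴾ compile b
    compile (a ∸ᵗ b)   = compile a ∸ᴾ compile b
    compile (a *ᵗ b)   = compile a *ᴾ compile b
    compile (app f ts) = compF (compile f) (compileAll ts)
    compile (rec g h)  = recF (compile g) (compile h)
    compile (sumᵗ t)   = sumP (compile t)
    compile (prodᵗ t)  = prodP (compile t)
    compile (prim p)   = p

    compileAll : ∀ {m n} → Vec (Term n) m → Vec (PR n) m
    compileAll []       = []
    compileAll (t ∷ ts) = compile t ∷ compileAll ts

  mutual
    eval-compile : ∀ {n} (t : Term n) v → eval (compile t) v ≡ ⟦ t ⟧ v
    eval-compile (var i)   v = refl
    eval-compile (lit k)   v = constP-eval k v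
    eval-compile (a +ᵗ b)  v =
      trans (addP-eval (eval (compile a) v) (eval (compile b) v))
            (cong₂ _+_ (eval-compile a v) (eval-compile b v))
    eval-compile (a ∸ᵗ b)  v =
      trans (monusP-eval (eval (compile b) v) (eval (compile a) v))
            (cong₂ _∸_ (eval-compile a v) (eval-compile b v))
    eval-compile (a *ᵗ b)  v =
      trans (mulP-eval (eval (compile a) v) (eval (compile b) v))
            (cong₂ _*_ (eval-compile a v) (eval-compile b v))
    eval-compile (app f ts) v =
      trans (cong (eval (compile f)) (evalAll-compileAll ts v)) (eval-compile f (⟦ ts ⟧* v))
    eval-compile (rec g h) (zero ∷ v)  = eval-compile g v
    eval-compile (rec g h) (suc k ∷ v) =
      trans (cong (λ r → eval (compile h) (k ∷ r ∷ v)) (eval-compile (rec g h) (k ∷ v)))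
            (eval-compile h (k ∷ ⟦ rec g h ⟧ (k ∷ v) ∷ v))
    eval-compile (sumᵗ t)  (k ∷ v) =
      trans (sumP-eval (compile t) k v) (sumTo-cong k (λ i _ → eval-compile t (i ∷ v)))
    eval-compile (prodᵗ t) (k ∷ v) =
      trans (prodP-eval (compile t) k v) (prodTo-cong k (λ i → eval-compile t (i ∷ v)))
    eval-compile (prim p)  v = refl

    evalAll-compileAll : ∀ {m n} (ts : Vec (Term n) m) v → evalAll (compileAll ts) v ≡ ⟦ ts ⟧* v
    evalAll-compileAll []       v = refl
    evalAll-compileAll (t ∷ ts) v = cong₂ _∷_ (eval-compile t v) (evalAll-compileAll ts v)

module Pairing where

  tri-mono-≤ : ∀ {m n} → m ≤ n → tri m ≤ tri n
  tri-mono-≤ {m} {zero}  z≤n = ≤-refl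
  tri-mono-≤ {m} {suc n} m≤1+n with m≤n⇒m<n∨m≡n m≤1+n
  ... | inj₂ refl       = ≤-refl
  ... | inj₁ (s≤s m≤n) = ≤-trans (tri-mono-≤ m≤n) (m≤n+m (tri n) (suc n))

  n≤tri[n] : ∀ n → n ≤ tri n
  n≤tri[n] zero    = z≤n
  n≤tri[n] (suc n) = m≤m+n (suc n) (tri n)

  InDiagonal : ℕ → ℕ → Set
  InDiagonal s c = tri s ≤ c × c < tri (suc s)

  InDiagonal-unique : ∀ {s s' c} → InDiagonal s c → InDiagonal s' c → s ≡ s'
  InDiagonal-unique {s} {s'} (l , u) (l' , u') with <-cmp s s'
  ... | tri≈ _ s≡s' _ = s≡s'
  ... | tri< s<s' _ _ = ⊥-elim (<-irrefl refl (<-≤-trans u (≤-trans (tri-mono-≤ s<s') l')))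
  ... | tri> _ _ s'<s = ⊥-elim (<-irrefl refl (<-≤-trans u' (≤-trans (tri-mono-≤ s'<s) l)))

  -- Written with truncated subtraction only, so that it is a primitive recursive term:
  -- the increment is 1 exactly when suc c reaches the next diagonal.
  diag : ℕ → ℕ
  diag zero    = 0
  diag (suc c) = diag c + (1 ∸ (tri (suc (diag c)) ∸ suc c))

  1∸-positive : ∀ {x} → 0 < x → 1 ∸ x ≡ 0
  1∸-positive {suc x} _ = 0∸n≡0 x

  InDiagonal-suc : ∀ s c → InDiagonal s c → InDiagonal (s + (1 ∸ (tri (suc s) ∸ suc c))) (suc c)
  InDiagonal-suc s c (l , u) with tri (suc s) ≤? suc c
  ... | yes reached rewrite m≤n⇒m∸n≡0 reached | +-comm s 1 =
    reached , s≤s (≤-trans u (m≤n+m (tri (suc s)) (suc s)))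
  ... | no  below
    rewrite 1∸-positive (m<n⇒0<n∸m (≰⇒> below)) | +-identityʳ s = m≤n⇒m≤1+n l , ≰⇒> below

  InDiagonal-diag : ∀ c → InDiagonal (diag c) c
  InDiagonal-diag zero    = z≤n , s≤s z≤n
  InDiagonal-diag (suc c) = InDiagonal-suc (diag c) c (InDiagonal-diag c)

  InDiagonal-pair : ∀ a b → InDiagonal (a + b) (pair a b)
  InDiagonal-pair a b = m≤m+n (tri (a + b)) b ,
    subst (_< tri (suc (a + b))) (+-comm b (tri (a + b))) (+-monoˡ-< (tri (a + b)) (s≤s (m≤n+m b a)))

  diag-pair : ∀ a b → diag (pair a b) ≡ a + b
  diag-pair a b = InDiagonal-unique (InDiagonal-diag (pair a b)) (InDiagonal-pair a b)

  unpair₂ : ℕ → ℕ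
  unpair₂ c = c ∸ tri (diag c)

  unpair₁ : ℕ → ℕ
  unpair₁ c = diag c ∸ unpair₂ c

  unpair₂-pair : ∀ a b → unpair₂ (pair a b) ≡ b
  unpair₂-pair a b rewrite diag-pair a b = m+n∸m≡n (tri (a + b)) b

  unpair₁-pair : ∀ a b → unpair₁ (pair a b) ≡ a
  unpair₁-pair a b rewrite unpair₂-pair a b | diag-pair a b = m+n∸n≡m a b

  unpair₂≤diag : ∀ c → unpair₂ c ≤ diag c
  unpair₂≤diag c = ≤-pred (m<n+o⇒m∸n<o c (tri d) (subst (c <_) (+-comm (suc d) (tri d)) c<tri[1+d]))
    where
      d : ℕ
      d = diag c
      c<tri[1+d] : c < tri (suc d)
      c<tri[1+d] = proj₂ (InDiagonal-diag c)

  pair-unpair : ∀ c → pair (unpair₁ c) (unpair₂ c) ≡ c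
  pair-unpair c rewrite m∸n+n≡m (unpair₂≤diag c) = m+[n∸m]≡n (proj₁ (InDiagonal-diag c))

  unpair₂<n : ∀ c → 0 < c → unpair₂ c < c
  unpair₂<n c 0<c with diag c in eq
  ... | zero  = ⊥-elim (<-irrefl refl (<-≤-trans 0<c (subst (λ t → c ∸ tri t ≤ t) eq (unpair₂≤diag c))))
  ... | suc s = ∸-monoʳ-< {c} {suc s + tri s} {0} (s≤s z≤n)
                          (subst (λ t → tri t ≤ c) eq (proj₁ (InDiagonal-diag c)))

  unpair₂≤n : ∀ c → unpair₂ c ≤ c
  unpair₂≤n zero    = z≤n
  unpair₂≤n (suc c) = <⇒≤ (unpair₂<n (suc c) (s≤s z≤n))

  unpair₁≤n : ∀ c → unpair₁ c ≤ c
  unpair₁≤n c =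
    ≤-trans (m∸n≤m (diag c) (unpair₂ c)) (≤-trans (n≤tri[n] (diag c)) (proj₁ (InDiagonal-diag c)))

  pair-injective : ∀ {a b a' b'} → pair a b ≡ pair a' b' → a ≡ a' × b ≡ b'
  pair-injective {a} {b} {a'} {b'} e =
    trans (sym (unpair₁-pair a b)) (trans (cong unpair₁ e) (unpair₁-pair a' b')) ,
    trans (sym (unpair₂-pair a b)) (trans (cong unpair₂ e) (unpair₂-pair a' b'))

  code-injective : ∀ {n} (v w : Vec ℕ n) → code v ≡ code w → v ≡ w
  code-injective []      []      _ = refl
  code-injective (x ∷ v) (y ∷ w) e with pair-injective e
  ... | x≡y , cv≡cw = cong₂ _∷_ x≡y (code-injective v w cv≡cw)

  m≤pair : ∀ a b → a ≤ pair a b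
  m≤pair a b = ≤-trans (≤-trans (m≤m+n a b) (n≤tri[n] (a + b))) (m≤m+n (tri (a + b)) b)

  n≤pair : ∀ a b → b ≤ pair a b
  n≤pair a b = m≤n+m b (tri (a + b))

  pair-mono-≤ : ∀ {a a' b b'} → a ≤ a' → b ≤ b' → pair a b ≤ pair a' b'
  pair-mono-≤ a≤a' b≤b' = +-mono-≤ (tri-mono-≤ (+-mono-≤ a≤a' b≤b')) b≤b'

  -- Entries beyond the length of the tuple are 0.
  entry : ℕ → ℕ → ℕ
  entry j z = unpair₁ (iterate unpair₂ z j)

  iterate-unpair₂-0 : ∀ j → iterate unpair₂ 0 j ≡ 0
  iterate-unpair₂-0 zero    = refl
  iterate-unpair₂-0 (suc j) = iterate-unpair₂-0 j

  iterate-unpair₂-≤ : ∀ j z → iterate unpair₂ z j ≤ z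
  iterate-unpair₂-≤ zero    z = ≤-refl
  iterate-unpair₂-≤ (suc j) z = ≤-trans (iterate-unpair₂-≤ j (unpair₂ z)) (unpair₂≤n z)

  iterate-unpair₂-large : ∀ j z → z ≤ j → iterate unpair₂ z j ≡ 0
  iterate-unpair₂-large zero    .zero   z≤n  = refl
  iterate-unpair₂-large (suc j) zero    _    = iterate-unpair₂-0 (suc j)
  iterate-unpair₂-large (suc j) (suc z) z≤j =
    iterate-unpair₂-large j (unpair₂ (suc z)) (≤-pred (<-≤-trans (unpair₂<n (suc z) (s≤s z≤n)) z≤j))

  entry-0 : ∀ j → entry j 0 ≡ 0
  entry-0 j rewrite iterate-unpair₂-0 j = refl

  entry-≤ : ∀ j z → entry j z ≤ z
  entry-≤ j z = ≤-trans (unpair₁≤n _) (iterate-unpair₂-≤ j z)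

  entry-large : ∀ j z → z ≤ j → entry j z ≡ 0
  entry-large j z z≤j rewrite iterate-unpair₂-large j z z≤j = refl

  entry-zero-pair : ∀ a b → entry 0 (pair a b) ≡ a
  entry-zero-pair = unpair₁-pair

  entry-suc-pair : ∀ j a b → entry (suc j) (pair a b) ≡ entry j b
  entry-suc-pair j a b = cong (λ t → unpair₁ (iterate unpair₂ t j)) (unpair₂-pair a b)

  entries-injective : ∀ a b → (∀ j → entry j a ≡ entry j b) → a ≡ b
  entries-injective a b = go (a + b) a b (m≤m+n a b) (m≤n+m b a)
    where
      unpair₂-bound : ∀ {n} c → c ≤ suc n → unpair₂ c ≤ n
      unpair₂-bound zero    _ = z≤n
      unpair₂-bound (suc c) c≤1+n = ≤-pred (<-≤-trans (unpair₂<n (suc c) (s≤s z≤n)) c≤1+n)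
      go : ∀ n a b → a ≤ n → b ≤ n → (∀ j → entry j a ≡ entry j b) → a ≡ b
      go zero    .zero .zero z≤n z≤n _ = refl
      go (suc n) a b a≤ b≤ same = begin
        a                            ≡⟨ pair-unpair a ⟨
        pair (unpair₁ a) (unpair₂ a) ≡⟨ cong₂ pair (same 0) tails ⟩
        pair (unpair₁ b) (unpair₂ b) ≡⟨ pair-unpair b ⟩
        b                            ∎
        where
          open ≡-Reasoning
          tails : unpair₂ a ≡ unpair₂ b
          tails = go n (unpair₂ a) (unpair₂ b) (unpair₂-bound a a≤) (unpair₂-bound b b≤)
                     (λ j → same (suc j))

module BinaryDigits where


  parity : ℕ → ℕ
  parity zero    = 0
  parity (suc k) = 1 ∸ parity k

  half : ℕ → ℕ
  half zero    = 0
  half (suc k) = half k + parity k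

  parity<2 : ∀ k → parity k < 2
  parity<2 zero    = s≤s z≤n
  parity<2 (suc k) with parity k | parity<2 k
  ... | 0 | _ = s≤s (s≤s z≤n)
  ... | 1 | _ = s≤s z≤n
  ... | suc (suc _) | s≤s (s≤s ())

  parity+half*2 : ∀ k → parity k + half k * 2 ≡ k
  parity+half*2 zero    = refl
  parity+half*2 (suc k) with parity k | parity<2 k | parity+half*2 k
  ... | 0 | _ | e rewrite +-identityʳ (half k) = cong suc e
  ... | 1 | _ | e rewrite +-comm (half k) 1 = cong suc e
  ... | suc (suc _) | s≤s (s≤s ()) | _

  divMod2-unique : ∀ r q → r < 2 → (r + q * 2) % 2 ≡ r × (r + q * 2) / 2 ≡ q
  divMod2-unique r q r<2 = mod , *-cancelʳ-≡ _ q 2 (sym (+-cancelˡ-≡ r (q * 2) _ divmod))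
    where
      mod : (r + q * 2) % 2 ≡ r
      mod = trans ([m+kn]%n≡m%n r q 2) (m<n⇒m%n≡m r<2)
      divmod : r + q * 2 ≡ r + (r + q * 2) / 2 * 2
      divmod = trans (m≡m%n+[m/n]*n (r + q * 2) 2) (cong (_+ (r + q * 2) / 2 * 2) mod)

  private
    divMod2 : ∀ u → u % 2 ≡ parity u × u / 2 ≡ half u
    divMod2 u = subst (λ t → t % 2 ≡ parity u × t / 2 ≡ half u) (parity+half*2 u)
                      (divMod2-unique (parity u) (half u) (parity<2 u))

  %2≡parity : ∀ u → u % 2 ≡ parity u
  %2≡parity u = proj₁ (divMod2 u)

  /2≡half : ∀ u → u / 2 ≡ half u
  /2≡half u = proj₂ (divMod2 u)

  bit-parity : ∀ u i → bit u i ≡ parity (iterate half u i)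
  bit-parity u zero                      = %2≡parity u
  bit-parity u (suc i) rewrite /2≡half u = bit-parity (half u) i

  bit-0 : ∀ i → bit 0 i ≡ 0
  bit-0 zero    = refl
  bit-0 (suc i) = bit-0 i

  bit-bound : ∀ u i → bit u i ≡ 1 → i < u
  bit-bound zero    i       b rewrite bit-0 i = ⊥-elim (0≢1+n b)
  bit-bound (suc u) zero    _ = s≤s z≤n
  bit-bound (suc u) (suc i) b =
    ≤-trans (s≤s (bit-bound (suc u / 2) i b)) (m/n<m (suc u) 2 (s≤s (s≤s z≤n)))

  2*m≢1+2*n : ∀ m n → 2 * m ≢ suc (2 * n)
  2*m≢1+2*n m n e = 0≢1+n (begin
    0                     ≡⟨ proj₁ (divMod2-unique 0 m (s≤s z≤n)) ⟨
    (0 + m * 2) % 2       ≡⟨ cong (_% 2) (*-comm m 2) ⟩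
    (2 * m) % 2           ≡⟨ cong (_% 2) e ⟩
    suc (2 * n) % 2       ≡⟨ cong (λ t → suc t % 2) (*-comm 2 n) ⟩
    (1 + n * 2) % 2       ≡⟨ proj₁ (divMod2-unique 1 n (s≤s (s≤s z≤n))) ⟩
    1                     ∎)
    where open ≡-Reasoning

  indicator : ∀ {A : Set} → Dec A → ℕ
  indicator (yes _) = 1
  indicator (no _)  = 0

  indicator<2 : ∀ {A : Set} (d : Dec A) → indicator d < 2
  indicator<2 (yes _) = s≤s (s≤s z≤n)
  indicator<2 (no _)  = s≤s z≤n

  setCode : {P : ℕ → Set} → Decidable P → ℕ → ℕ
  setCode P? zero    = 0
  setCode P? (suc N) = indicator (P? 0) + setCode (λ e → P? (suc e)) N * 2

  module _ {P : ℕ → Set} (P? : Decidable P) (N : ℕ) where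
    private
      u : ℕ
      u = setCode (λ e → P? (suc e)) N
      digits : (indicator (P? 0) + u * 2) % 2 ≡ indicator (P? 0) × (indicator (P? 0) + u * 2) / 2 ≡ u
      digits = divMod2-unique (indicator (P? 0)) u (indicator<2 (P? 0))

    bit-setCode-zero : bit (setCode P? (suc N)) 0 ≡ indicator (P? 0)
    bit-setCode-zero = proj₁ digits

    bit-setCode-suc : ∀ e → bit (setCode P? (suc N)) (suc e) ≡ bit u e
    bit-setCode-suc e = cong (λ t → bit t e) (proj₂ digits)

  setCode-sound : ∀ {P : ℕ → Set} (P? : Decidable P) N e → bit (setCode P? N) e ≡ 1 → P e
  setCode-sound P? zero    e       b rewrite bit-0 e = ⊥-elim (0≢1+n b)
  setCode-sound P? (suc N) zero    b with P? 0 | bit-setCode-zero P? N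
  ... | yes p | _ = p
  ... | no _  | e rewrite e = ⊥-elim (0≢1+n b)
  setCode-sound P? (suc N) (suc e) b =
    setCode-sound (λ e → P? (suc e)) N e (trans (sym (bit-setCode-suc P? N e)) b)

  setCode-complete : ∀ {P : ℕ → Set} (P? : Decidable P) N e → e < N → P e → bit (setCode P? N) e ≡ 1
  setCode-complete P? (suc N) zero    _ p with P? 0 | bit-setCode-zero P? N
  ... | yes _ | e = e
  ... | no ¬p | _ = ⊥-elim (¬p p)
  setCode-complete P? (suc N) (suc e) (s≤s e<N) p =
    trans (bit-setCode-suc P? N e) (setCode-complete (λ e → P? (suc e)) N e e<N p)

module ArithmeticTerms where

  open Terms
  open Pairing
  open BinaryDigits

  x₀ : ∀ {n} → Term (suc n)
  x₀ = var zero

  x₁ : ∀ {n} → Term (suc (suc n))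
  x₁ = var (suc zero)

  x₂ : ∀ {n} → Term (suc (suc (suc n)))
  x₂ = var (suc (suc zero))

  x₃ : ∀ {n} → Term (suc (suc (suc (suc n))))
  x₃ = var (suc (suc (suc zero)))

  triᵗ : Term 1
  triᵗ = rec (lit 0) ((lit 1 +ᵗ x₀) +ᵗ x₁)

  triᵗ-sem : ∀ k → ⟦ triᵗ ⟧ (k ∷ []) ≡ tri k
  triᵗ-sem zero                         = refl
  triᵗ-sem (suc k) rewrite triᵗ-sem k = refl

  pairᵗ : Term 2
  pairᵗ = app triᵗ ((x₀ +ᵗ x₁) ∷ []) +ᵗ x₁

  pairᵗ-sem : ∀ a b → ⟦ pairᵗ ⟧ (a ∷ b ∷ []) ≡ pair a b
  pairᵗ-sem a b rewrite triᵗ-sem (a + b) = refl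

  diagᵗ : Term 1
  diagᵗ = rec (lit 0) (x₁ +ᵗ (lit 1 ∸ᵗ (app triᵗ ((lit 1 +ᵗ x₁) ∷ []) ∸ᵗ (lit 1 +ᵗ x₀))))

  diagᵗ-sem : ∀ c → ⟦ diagᵗ ⟧ (c ∷ []) ≡ diag c
  diagᵗ-sem zero = refl
  diagᵗ-sem (suc c) rewrite diagᵗ-sem c | triᵗ-sem (diag c) = refl

  unpair₂ᵗ : Term 1
  unpair₂ᵗ = x₀ ∸ᵗ app triᵗ (app diagᵗ (x₀ ∷ []) ∷ [])

  unpair₂ᵗ-sem : ∀ c → ⟦ unpair₂ᵗ ⟧ (c ∷ []) ≡ unpair₂ c
  unpair₂ᵗ-sem c rewrite diagᵗ-sem c | triᵗ-sem (diag c) = refl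

  unpair₁ᵗ : Term 1
  unpair₁ᵗ = app diagᵗ (x₀ ∷ []) ∸ᵗ unpair₂ᵗ

  unpair₁ᵗ-sem : ∀ c → ⟦ unpair₁ᵗ ⟧ (c ∷ []) ≡ unpair₁ c
  unpair₁ᵗ-sem c rewrite diagᵗ-sem c | triᵗ-sem (diag c) = refl

  parityᵗ : Term 1
  parityᵗ = rec (lit 0) (lit 1 ∸ᵗ x₁)

  parityᵗ-sem : ∀ k → ⟦ parityᵗ ⟧ (k ∷ []) ≡ parity k
  parityᵗ-sem zero                            = refl
  parityᵗ-sem (suc k) rewrite parityᵗ-sem k = refl

  halfᵗ : Term 1
  halfᵗ = rec (lit 0) (x₁ +ᵗ app parityᵗ (x₀ ∷ []))

  halfᵗ-sem : ∀ k → ⟦ halfᵗ ⟧ (k ∷ []) ≡ half k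
  halfᵗ-sem zero                                            = refl
  halfᵗ-sem (suc k) rewrite halfᵗ-sem k | parityᵗ-sem k = refl

  iterateᵗ : Term 1 → Term 2
  iterateᵗ F = rec x₀ (app F (x₁ ∷ []))

  iterateᵗ-sem : ∀ (F : Term 1) {g : ℕ → ℕ} → (∀ y → ⟦ F ⟧ (y ∷ []) ≡ g y) →
                 ∀ i x → ⟦ iterateᵗ F ⟧ (i ∷ x ∷ []) ≡ iterate g x i
  iterateᵗ-sem F {g} F≗g i x = trans (fold-sem i) (iterate-is-fold x g i)
    where
      fold-sem : ∀ i → ⟦ iterateᵗ F ⟧ (i ∷ x ∷ []) ≡ fold x g i
      fold-sem zero    = refl
      fold-sem (suc i) = trans (F≗g _) (cong g (fold-sem i))

  bitᵗ : Term 2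
  bitᵗ = app parityᵗ (app (iterateᵗ halfᵗ) (x₁ ∷ x₀ ∷ []) ∷ [])

  bitᵗ-sem : ∀ u i → ⟦ bitᵗ ⟧ (u ∷ i ∷ []) ≡ bit u i
  bitᵗ-sem u i rewrite iterateᵗ-sem halfᵗ halfᵗ-sem i u =
    trans (parityᵗ-sem (iterate half u i)) (sym (bit-parity u i))

  entryᵗ : Term 2
  entryᵗ = app unpair₁ᵗ (app (iterateᵗ unpair₂ᵗ) (x₀ ∷ x₁ ∷ []) ∷ [])

  entryᵗ-sem : ∀ j z → ⟦ entryᵗ ⟧ (j ∷ z ∷ []) ≡ entry j z
  entryᵗ-sem j z rewrite iterateᵗ-sem unpair₂ᵗ unpair₂ᵗ-sem j z =
    unpair₁ᵗ-sem (iterate unpair₂ z j)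

module ZeroTests where

  open PrimitiveRecursive using (sumTo; prodTo)

  infix 4 _≡0⇔_

  _≡0⇔_ : ℕ → Set → Set
  n ≡0⇔ A = (n ≡ 0) ⇔ A

  ≡0⇔-resp : ∀ {x y A} → x ≡ y → y ≡0⇔ A → x ≡0⇔ A
  ≡0⇔-resp refl t = t

  ∸+∸-≡0⇔-≡ : ∀ x y → (x ∸ y) + (y ∸ x) ≡0⇔ (x ≡ y)
  ∸+∸-≡0⇔-≡ x y = mk⇔
    (λ e → ≤-antisym (m∸n≡0⇒m≤n (m+n≡0⇒m≡0 (x ∸ y) e)) (m∸n≡0⇒m≤n (m+n≡0⇒n≡0 (x ∸ y) e)))
    (λ { refl → cong₂ _+_ (n∸n≡0 x) (n∸n≡0 x) })

  +-≡0⇔-× : ∀ {x y A B} → x ≡0⇔ A → y ≡0⇔ B → x + y ≡0⇔ (A × B)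
  +-≡0⇔-× {x} tA tB = mk⇔
    (λ e → to tA (m+n≡0⇒m≡0 x e) , to tB (m+n≡0⇒n≡0 x e))
    (λ (a , b) → cong₂ _+_ (from tA a) (from tB b))

  *-≡0⇔-⊎ : ∀ {x y A B} → x ≡0⇔ A → y ≡0⇔ B → x * y ≡0⇔ (A ⊎ B)
  *-≡0⇔-⊎ {x} {y} {A} {B} tA tB = mk⇔ split join
    where
      split : x * y ≡ 0 → A ⊎ B
      split e with m*n≡0⇒m≡0∨n≡0 x e
      ... | inj₁ x≡0 = inj₁ (to tA x≡0)
      ... | inj₂ y≡0 = inj₂ (to tB y≡0)
      join : A ⊎ B → x * y ≡ 0
      join (inj₁ a) rewrite from tA a = refl
      join (inj₂ b) rewrite from tB b = *-zeroʳ x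

  1∸-≡0⇔-¬ : ∀ {x A} → x ≡0⇔ A → 1 ∸ x ≡0⇔ (¬ A)
  1∸-≡0⇔-¬ {zero}  tA = mk⇔ (λ ()) (λ ¬a → ⊥-elim (¬a (to tA refl)))
  1∸-≡0⇔-¬ {suc x} tA = mk⇔ (λ _ a → 0≢1+n (sym (from tA a))) (λ _ → 0∸n≡0 x)

  →-≡0⇔ : ∀ {x y A B} → Dec A → x ≡0⇔ A → y ≡0⇔ B → (1 ∸ x) * y ≡0⇔ (A → B)
  →-≡0⇔ {x} {y} {A} {B} A? tA tB = mk⇔
    (λ e a → case to t e of λ { (inj₁ ¬a) → ⊥-elim (¬a a) ; (inj₂ b) → b })
    (λ f → from t (case A? of λ { (yes a) → inj₂ (f a) ; (no ¬a) → inj₁ ¬a }))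
    where
      t : (1 ∸ x) * y ≡0⇔ (¬ A ⊎ B)
      t = *-≡0⇔-⊎ (1∸-≡0⇔-¬ tA) tB

  sumTo-≡0⇔-∀< : ∀ b {F : ℕ → ℕ} {P : ℕ → Set} → (∀ i → F i ≡0⇔ P i) →
                 sumTo b F ≡0⇔ (∀ i → i < b → P i)
  sumTo-≡0⇔-∀< zero    t = mk⇔ (λ _ _ ()) (λ _ → refl)
  sumTo-≡0⇔-∀< (suc b) {F} {P} t = mk⇔
    (λ e i i<1+b → case m≤n⇒m<n∨m≡n i<1+b of λ
      { (inj₁ (s≤s i<b)) → proj₁ (to tb e) i i<b
      ; (inj₂ refl)     → proj₂ (to tb e) })
    (λ p → from tb ((λ i i<b → p i (m<n⇒m<1+n i<b)) , p b ≤-refl))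
    where
      tb : sumTo (suc b) F ≡0⇔ ((∀ i → i < b → P i) × P b)
      tb = +-≡0⇔-× (sumTo-≡0⇔-∀< b t) (t b)

  prodTo-≡0⇔-∃< : ∀ b {F : ℕ → ℕ} {P : ℕ → Set} → (∀ i → F i ≡0⇔ P i) →
                  prodTo b F ≡0⇔ (∃ λ i → i < b × P i)
  prodTo-≡0⇔-∃< zero    t = mk⇔ (λ ()) (λ ())
  prodTo-≡0⇔-∃< (suc b) {F} {P} t = mk⇔ split join
    where
      tb : prodTo (suc b) F ≡0⇔ ((∃ λ i → i < b × P i) ⊎ P b)
      tb = *-≡0⇔-⊎ (prodTo-≡0⇔-∃< b t) (t b)
      split : prodTo (suc b) F ≡ 0 → ∃ λ i → i < suc b × P i
      split e with to tb e
      ... | inj₁ (i , i<b , p) = i , m<n⇒m<1+n i<b , p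
      ... | inj₂ p             = b , ≤-refl , p
      join : (∃ λ i → i < suc b × P i) → prodTo (suc b) F ≡ 0
      join (i , i<1+b , p) with m≤n⇒m<n∨m≡n i<1+b
      ... | inj₁ (s≤s i<b) = from tb (inj₁ (i , i<b , p))
      ... | inj₂ refl      = from tb (inj₂ p)

LeastWitnessBelow : (ℕ → Set) → ℕ → Set
LeastWitnessBelow P x = ∃ λ m → P m × m ≤ x × (∀ k → k < m → ¬ P k)

least-witness : ∀ {P : ℕ → Set} → Decidable P → ∀ x → P x → LeastWitnessBelow P x
least-witness {P} P? = <-rec _ step
  where
    step : ∀ x → (∀ {y} → y < x → P y → LeastWitnessBelow P y) → P x → LeastWitnessBelow P x
    step x rec p with anyUpTo? P? x
    ... | no none = x , p , ≤-refl , λ k k<x pk → none (k , k<x , pk)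
    ... | yes (y , y<x , py) with rec y<x py
    ...   | m , pm , m≤y , below = m , pm , ≤-trans m≤y (<⇒≤ y<x) , below

-- enum lists the first occurrences of the values of f in increasing order, so f ∘ enum is a bijection.
module FirstOccurrences (f : ℕ → ℕ) (f-surjective : Surjective f) where

  open PrimitiveRecursive using (sumTo; sumTo-mono-≤; term≤sumTo)
  open BinaryDigits using (indicator)

  Fresh : ℕ → Set
  Fresh r = ¬ (∃ λ k → k < r × f k ≡ f r)

  Fresh? : Decidable Fresh
  Fresh? r = ¬? (anyUpTo? (λ k → f k ≟ f r) r)

  ¬Fresh⇒repeat : ∀ {r} → ¬ Fresh r → ∃ λ k → k < r × f k ≡ f r
  ¬Fresh⇒repeat {r} = decidable-stable (anyUpTo? (λ k → f k ≟ f r) r)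

  Fresh-injective : ∀ {r r'} → Fresh r → Fresh r' → f r ≡ f r' → r ≡ r'
  Fresh-injective {r} {r'} fr fr' e with <-cmp r r'
  ... | tri≈ _ r≡r' _ = r≡r'
  ... | tri< r<r' _ _ = ⊥-elim (fr' (r , r<r' , e))
  ... | tri> _ _ r'<r = ⊥-elim (fr (r' , r'<r , sym e))

  fresh-preimage : ∀ y → ∃ λ r → Fresh r × f r ≡ y
  fresh-preimage y with f-surjective y
  ... | x , fx≡y with least-witness (λ k → f k ≟ y) x fx≡y
  ...   | r , fr≡y , _ , below = r , (λ (k , k<r , e) → below k k<r (trans e fr≡y)) , fr≡y

  #fresh : ℕ → ℕ
  #fresh n = sumTo n (λ r → indicator (Fresh? r))

  #fresh-suc : ∀ {r} → Fresh r → #fresh (suc r) ≡ suc (#fresh r)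
  #fresh-suc {r} fr with Fresh? r
  ... | yes _  = +-comm (#fresh r) 1
  ... | no ¬fr = ⊥-elim (¬fr fr)

  #fresh-strict : ∀ {r r'} → Fresh r → r < r' → #fresh r < #fresh r'
  #fresh-strict {r} {r'} fr r<r' =
    subst (_≤ #fresh r') (#fresh-suc fr) (sumTo-mono-≤ (λ r → indicator (Fresh? r)) r<r')

  #fresh-gap : ∀ r j → r < j → (∀ k → r < k → k < j → ¬ Fresh k) → #fresh j ≡ #fresh (suc r)
  #fresh-gap r (suc j) r<1+j none with m≤n⇒m<n∨m≡n r<1+j
  ... | inj₂ refl = refl
  ... | inj₁ (s≤s r<j) with Fresh? j
  ...   | yes fj = ⊥-elim (none j r<j ≤-refl fj)
  ...   | no _   = trans (+-identityʳ (#fresh j))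
                         (#fresh-gap r j r<j (λ k r<k k<j → none k r<k (m<n⇒m<1+n k<j)))

  -- r is the a-th fresh index, counting from 0.
  NthFresh : ℕ → ℕ → Set
  NthFresh a r = Fresh r × #fresh r ≡ a

  NthFresh-functional : ∀ {a r r'} → NthFresh a r → NthFresh a r' → r ≡ r'
  NthFresh-functional {a} {r} {r'} (fr , #r) (fr' , #r') with <-cmp r r'
  ... | tri≈ _ r≡r' _ = r≡r'
  ... | tri< r<r' _ _ = ⊥-elim (<-irrefl (trans #r (sym #r')) (#fresh-strict fr r<r'))
  ... | tri> _ _ r'<r = ⊥-elim (<-irrefl (trans #r' (sym #r)) (#fresh-strict fr' r'<r))

  NthFresh-0-0 : NthFresh 0 0
  NthFresh-0-0 = (λ ()) , refl

  -- A value larger than f 0, …, f r has a fresh preimage beyond r.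
  fresh-above : ∀ r → ∃ λ x → r < x × Fresh x
  fresh-above r with fresh-preimage (suc (sumTo (suc r) f))
  ... | x , fx , fx≡big with x ≤? r
  ...   | yes x≤r =
    ⊥-elim (<-irrefl refl (subst (_≤ sumTo (suc r) f) fx≡big (term≤sumTo (suc r) f (s≤s x≤r))))
  ...   | no  x≰r = x , ≰⇒> x≰r , fx

  nthFresh : ∀ a → ∃ (NthFresh a)
  nthFresh zero = 0 , NthFresh-0-0
  nthFresh (suc a) with nthFresh a
  ... | r , fr , #r with fresh-above r
  ...   | x , r<x , fx with least-witness (λ k → (r <? k) ×-dec Fresh? k) x (r<x , fx)
  ...     | j , (r<j , fj) , _ , below =
    j , fj , trans (#fresh-gap r j r<j (λ k r<k k<j fk → below k k<j (r<k , fk)))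
                   (trans (#fresh-suc fr) (cong suc #r))

  enum : ℕ → ℕ
  enum a = proj₁ (nthFresh a)

  enum-NthFresh : ∀ a → NthFresh a (enum a)
  enum-NthFresh a = proj₂ (nthFresh a)

  NthFresh⇒enum : ∀ {a r} → NthFresh a r → enum a ≡ r
  NthFresh⇒enum {a} = NthFresh-functional (enum-NthFresh a)

  bijection : ℕ → ℕ
  bijection a = f (enum a)

  bijection-injective : Injective bijection
  bijection-injective a b e = begin
    a                ≡⟨ proj₂ (enum-NthFresh a) ⟨
    #fresh (enum a)  ≡⟨ cong #fresh (Fresh-injective (proj₁ (enum-NthFresh a)) (proj₁ (enum-NthFresh b)) e) ⟩
    #fresh (enum b)  ≡⟨ proj₂ (enum-NthFresh b) ⟩
    b                ∎
    where open ≡-Reasoning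

  bijection-surjective : Surjective bijection
  bijection-surjective y with fresh-preimage y
  ... | r , fr , fr≡y = #fresh r , trans (cong f (NthFresh⇒enum (fr , refl))) fr≡y

module ElementCodes where

  open Pairing
  open Terms
  open ArithmeticTerms

  -- The positions in P = (=) ⊕ ((≠) ⊕ ⊕ᵢ Rᵢ) of ⟨a, b⟩ ∈ (=), of ⟨a, b⟩ ∈ (≠) and of ⟨i, z⟩ ∈ ⊕ᵢ Rᵢ.
  eqCode : ℕ → ℕ → ℕ
  eqCode a b = 2 * code (a ∷ b ∷ [])

  neqCode : ℕ → ℕ → ℕ
  neqCode a b = suc (2 * (2 * code (a ∷ b ∷ [])))

  relCode : ℕ → ℕ → ℕ
  relCode i z = suc (2 * suc (2 * pair i z))

  m≤2*m : ∀ m → m ≤ 2 * m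
  m≤2*m m = m≤m+n m (m + 0)

  m≤1+2*m : ∀ m → m ≤ suc (2 * m)
  m≤1+2*m m = ≤-trans (m≤2*m m) (n≤1+n _)

  eqCode≤neqCode : ∀ a b → eqCode a b ≤ neqCode a b
  eqCode≤neqCode a b = ≤-trans (*-monoʳ-≤ 2 (m≤2*m (code (a ∷ b ∷ [])))) (n≤1+n _)

  m≤eqCode : ∀ a b → a ≤ eqCode a b
  m≤eqCode a b = ≤-trans (m≤pair a _) (m≤2*m _)

  n≤eqCode : ∀ a b → b ≤ eqCode a b
  n≤eqCode a b = ≤-trans (≤-trans (m≤pair b 0) (n≤pair a (pair b 0))) (m≤2*m _)

  m≤neqCode : ∀ a b → a ≤ neqCode a b
  m≤neqCode a b = ≤-trans (m≤eqCode a b) (eqCode≤neqCode a b)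

  n≤neqCode : ∀ a b → b ≤ neqCode a b
  n≤neqCode a b = ≤-trans (n≤eqCode a b) (eqCode≤neqCode a b)

  pair≤relCode : ∀ i z → pair i z ≤ relCode i z
  pair≤relCode i z = ≤-trans (m≤1+2*m (pair i z)) (m≤1+2*m (suc (2 * pair i z)))

  m≤relCode : ∀ i z → i ≤ relCode i z
  m≤relCode i z = ≤-trans (m≤pair i z) (pair≤relCode i z)

  n≤relCode : ∀ i z → z ≤ relCode i z
  n≤relCode i z = ≤-trans (n≤pair i z) (pair≤relCode i z)

  neqCode-mono-≤ : ∀ {a a' b b'} → a ≤ a' → b ≤ b' → neqCode a b ≤ neqCode a' b'
  neqCode-mono-≤ a≤a' b≤b' = s≤s (*-monoʳ-≤ 2 (*-monoʳ-≤ 2 (pair-mono-≤ a≤a' (pair-mono-≤ b≤b' ≤-refl))))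

  relCode-monoˡ-≤ : ∀ {i i'} z → i ≤ i' → relCode i z ≤ relCode i' z
  relCode-monoˡ-≤ z i≤i' = s≤s (*-monoʳ-≤ 2 (s≤s (*-monoʳ-≤ 2 (pair-mono-≤ i≤i' ≤-refl))))

  code₂ᵗ : Term 2
  code₂ᵗ = app pairᵗ (x₀ ∷ app pairᵗ (x₁ ∷ lit 0 ∷ []) ∷ [])

  code₂ᵗ-sem : ∀ a b → ⟦ code₂ᵗ ⟧ (a ∷ b ∷ []) ≡ code (a ∷ b ∷ [])
  code₂ᵗ-sem a b rewrite pairᵗ-sem b 0 = pairᵗ-sem a (pair b 0)

  eqCodeᵗ : Term 2
  eqCodeᵗ = lit 2 *ᵗ code₂ᵗ

  eqCodeᵗ-sem : ∀ a b → ⟦ eqCodeᵗ ⟧ (a ∷ b ∷ []) ≡ eqCode a b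
  eqCodeᵗ-sem a b = cong (2 *_) (code₂ᵗ-sem a b)

  neqCodeᵗ : Term 2
  neqCodeᵗ = lit 1 +ᵗ (lit 2 *ᵗ (lit 2 *ᵗ code₂ᵗ))

  neqCodeᵗ-sem : ∀ a b → ⟦ neqCodeᵗ ⟧ (a ∷ b ∷ []) ≡ neqCode a b
  neqCodeᵗ-sem a b = cong (λ t → suc (2 * (2 * t))) (code₂ᵗ-sem a b)

  relCodeᵗ : Term 2
  relCodeᵗ = lit 1 +ᵗ (lit 2 *ᵗ (lit 1 +ᵗ (lit 2 *ᵗ pairᵗ)))

  relCodeᵗ-sem : ∀ i z → ⟦ relCodeᵗ ⟧ (i ∷ z ∷ []) ≡ relCode i z
  relCodeᵗ-sem i z = cong (λ t → suc (2 * suc (2 * t))) (pairᵗ-sem i z)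

module PresentationCodes (L : Language) where

  open Pairing
  open BinaryDigits using (2*m≢1+2*n)

  ⊕-even⁻ : ∀ {A B : SetN} {x} → (A ⊕ B) (2 * x) → A x
  ⊕-even⁻ {A} {x = x} (inj₁ (y , e , a)) = subst A (*-cancelˡ-≡ y x 2 (sym e)) a
  ⊕-even⁻ {x = x} (inj₂ (y , e , _)) = ⊥-elim (2*m≢1+2*n x y e)

  ⊕-odd⁻ : ∀ {A B : SetN} {x} → (A ⊕ B) (suc (2 * x)) → B x
  ⊕-odd⁻ {x = x} (inj₁ (y , e , _)) = ⊥-elim (2*m≢1+2*n y x (sym e))
  ⊕-odd⁻ {B = B} {x} (inj₂ (y , e , b)) = subst B (*-cancelˡ-≡ y x 2 (sym (suc-injective e))) b

  tuples⁻ : ∀ {n} {X : Vec ℕ n → Set} {v} → tuples X (code v) → X v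
  tuples⁻ {v = v} (w , cw≡cv , x) rewrite code-injective w v cw≡cv = x

  tuples⁺ : ∀ {n} {X : Vec ℕ n → Set} {v} → X v → tuples X (code v)
  tuples⁺ {v = v} x = v , refl , x

  open ElementCodes

  module _ (I : Interp L) where

    eqCode⁻ : ∀ {a b} → Pᵢ I (eqCode a b) → eqR I (a ∷ b ∷ [])
    eqCode⁻ p = tuples⁻ (⊕-even⁻ p)

    neqCode⁻ : ∀ {a b} → Pᵢ I (neqCode a b) → neqR I (a ∷ b ∷ [])
    neqCode⁻ p = tuples⁻ (⊕-even⁻ (⊕-odd⁻ p))

    relCode⁻ : ∀ {i z} → Pᵢ I (relCode i z) →
               ∃ λ idx → idxℕ L idx ≡ i × ∃ λ v → code v ≡ z × relR I idx v
    relCode⁻ {i} {z} p with ⊕-odd⁻ (⊕-odd⁻ p)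
    ... | idx , x , e , (v , cv , r) with pair-injective {i} {z} {idxℕ L idx} {x} e
    ...   | refl , refl = idx , refl , v , cv , r

    eqCode⁺ : ∀ {a b} → eqR I (a ∷ b ∷ []) → Pᵢ I (eqCode a b)
    eqCode⁺ r = inj₁ (_ , refl , tuples⁺ r)

    neqCode⁺ : ∀ {a b} → neqR I (a ∷ b ∷ []) → Pᵢ I (neqCode a b)
    neqCode⁺ r = inj₂ (_ , refl , inj₁ (_ , refl , tuples⁺ r))

    relCode⁺ : ∀ idx {v} → relR I idx v → Pᵢ I (relCode (idxℕ L idx) (code v))
    relCode⁺ idx r = inj₂ (_ , refl , inj₂ (_ , refl , (idx , _ , refl , tuples⁺ r)))

    data PView (c : ℕ) : Set where
      eq-view  : ∀ a b → c ≡ eqCode a b → eqR I (a ∷ b ∷ []) → PView c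
      neq-view : ∀ a b → c ≡ neqCode a b → neqR I (a ∷ b ∷ []) → PView c
      rel-view : ∀ idx v → c ≡ relCode (idxℕ L idx) (code v) → relR I idx v → PView c

    viewP : ∀ {c} → Pᵢ I c → PView c
    viewP (inj₁ (_ , refl , (a ∷ b ∷ [] , refl , r)))                   = eq-view a b refl r
    viewP (inj₂ (_ , refl , inj₁ (_ , refl , (a ∷ b ∷ [] , refl , r)))) = neq-view a b refl r
    viewP (inj₂ (_ , refl , inj₂ (_ , refl , (idx , _ , refl , (v , refl , r))))) =
      rel-view idx v refl r

-- Finite certificates: u is read as a finite set D u of claimed elements of P(f⁻¹(𝓐)),
-- which is all the information an enumeration operator may consult.
module Certificates where

  open PrimitiveRecursive using (sumTo)
  open Terms
  open ArithmeticTerms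
  open Pairing using (entry)
  open ElementCodes
  open ZeroTests

  infix 4 _≟ᵗ_ _∋ᵗ_

  _≟ᵗ_ : ∀ {n} → Term n → Term n → Term n
  a ≟ᵗ b = (a ∸ᵗ b) +ᵗ (b ∸ᵗ a)

  ≟ᵗ-sem : ∀ {n} (a b : Term n) v {x y} → ⟦ a ⟧ v ≡ x → ⟦ b ⟧ v ≡ y → ⟦ a ≟ᵗ b ⟧ v ≡0⇔ (x ≡ y)
  ≟ᵗ-sem a b v refl refl = ∸+∸-≡0⇔-≡ (⟦ a ⟧ v) (⟦ b ⟧ v)

  _∋ᵗ_ : ∀ {n} → Term n → Term n → Term n
  u ∋ᵗ e = app bitᵗ (u ∷ e ∷ []) ≟ᵗ lit 1

  ∋ᵗ-sem : ∀ {n} (u e : Term n) v {x} → ⟦ e ⟧ v ≡ x → ⟦ u ∋ᵗ e ⟧ v ≡0⇔ D (⟦ u ⟧ v) x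
  ∋ᵗ-sem u e v refl = ≟ᵗ-sem (app bitᵗ (u ∷ e ∷ [])) (lit 1) v (bitᵗ-sem (⟦ u ⟧ v) (⟦ e ⟧ v)) refl

  FreshCert : ℕ → ℕ → Set
  FreshCert u j = ∀ k → k < j → D u (neqCode k j)

  RepeatCert : ℕ → ℕ → Set
  RepeatCert u j = ∃ λ k → k < j × D u (eqCode k j)

  freshᵗ : Term 2
  freshᵗ = app (sumᵗ (x₁ ∋ᵗ app neqCodeᵗ (x₀ ∷ x₂ ∷ []))) (x₁ ∷ x₀ ∷ x₁ ∷ [])

  freshᵗ-sem : ∀ u j → ⟦ freshᵗ ⟧ (u ∷ j ∷ []) ≡0⇔ FreshCert u j
  freshᵗ-sem u j = sumTo-≡0⇔-∀< j λ k →
    ∋ᵗ-sem x₁ (app neqCodeᵗ (x₀ ∷ x₂ ∷ [])) (k ∷ u ∷ j ∷ []) (neqCodeᵗ-sem k j)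

  repeatᵗ : Term 2
  repeatᵗ = app (prodᵗ (x₁ ∋ᵗ app eqCodeᵗ (x₀ ∷ x₂ ∷ []))) (x₁ ∷ x₀ ∷ x₁ ∷ [])

  repeatᵗ-sem : ∀ u j → ⟦ repeatᵗ ⟧ (u ∷ j ∷ []) ≡0⇔ RepeatCert u j
  repeatᵗ-sem u j = prodTo-≡0⇔-∃< j λ k →
    ∋ᵗ-sem x₁ (app eqCodeᵗ (x₀ ∷ x₂ ∷ [])) (k ∷ u ∷ j ∷ []) (eqCodeᵗ-sem k j)

  #freshCert : ℕ → ℕ → ℕ
  #freshCert u r = sumTo r (λ j → 1 ∸ ⟦ freshᵗ ⟧ (u ∷ j ∷ []))

  NthFreshCert : ℕ → ℕ → ℕ → Set
  NthFreshCert u a r =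
    (∀ j → j < suc r → FreshCert u j ⊎ RepeatCert u j) × FreshCert u r × #freshCert u r ≡ a

  nthFreshᵗ : Term 3
  nthFreshᵗ =
    app (sumᵗ (app freshᵗ (x₁ ∷ x₀ ∷ []) *ᵗ app repeatᵗ (x₁ ∷ x₀ ∷ []))) (lit 1 +ᵗ x₂ ∷ x₀ ∷ []) +ᵗ
    (app freshᵗ (x₀ ∷ x₂ ∷ []) +ᵗ
     (app (sumᵗ (lit 1 ∸ᵗ app freshᵗ (x₁ ∷ x₀ ∷ []))) (x₂ ∷ x₀ ∷ []) ≟ᵗ x₁))

  nthFreshᵗ-sem : ∀ u a r → ⟦ nthFreshᵗ ⟧ (u ∷ a ∷ r ∷ []) ≡0⇔ NthFreshCert u a r
  nthFreshᵗ-sem u a r =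
    +-≡0⇔-× (sumTo-≡0⇔-∀< (suc r) (λ j → *-≡0⇔-⊎ (freshᵗ-sem u j) (repeatᵗ-sem u j)))
      (+-≡0⇔-× (freshᵗ-sem u r) (∸+∸-≡0⇔-≡ (#freshCert u r) a))

  DiagonalEq : ℕ → Set
  DiagonalEq c = ∃ λ n → n < suc c × c ≡ eqCode n n

  OffDiagonalNeq : ℕ → Set
  OffDiagonalNeq c = ∃ λ n → n < suc c × ∃ λ m → m < suc c × (n ≢ m × c ≡ neqCode n m)

  -- c = ⟨i, z⟩ codes the tuple z in the i-th relation of the presentation; it is certified by a
  -- tuple z' of f⁻¹(𝓐) in D u whose entries u certifies to be the enumerated first occurrences
  -- with the indices given by the entries of z.
  RelCert : ℕ → ℕ → Set
  RelCert c u = ∃ λ i → i < suc c × ∃ λ z → z < suc c × (c ≡ relCode i z ×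
                ∃ λ z' → z' < u × (D u (relCode i z') ×
                  (∀ j → j < z + z' → NthFreshCert u (entry j z) (entry j z'))))

  Justified : ℕ → ℕ → Set
  Justified c u = DiagonalEq c ⊎ (OffDiagonalNeq c ⊎ RelCert c u)

  Certifies : ℕ → ℕ → Set
  Certifies uB u = ∀ c → c < uB → D uB c → Justified c u

  diagonalEqᵗ : Term 1
  diagonalEqᵗ = app (prodᵗ (x₁ ≟ᵗ app eqCodeᵗ (x₀ ∷ x₀ ∷ []))) (lit 1 +ᵗ x₀ ∷ x₀ ∷ [])

  diagonalEqᵗ-sem : ∀ c → ⟦ diagonalEqᵗ ⟧ (c ∷ []) ≡0⇔ DiagonalEq c
  diagonalEqᵗ-sem c = prodTo-≡0⇔-∃< (suc c) λ n →
    ≟ᵗ-sem x₁ (app eqCodeᵗ (x₀ ∷ x₀ ∷ [])) (n ∷ c ∷ []) refl (eqCodeᵗ-sem n n)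

  offDiagonalNeqᵗ : Term 1
  offDiagonalNeqᵗ =
    app (prodᵗ (app (prodᵗ ((lit 1 ∸ᵗ (x₁ ≟ᵗ x₀)) +ᵗ (x₂ ≟ᵗ app neqCodeᵗ (x₁ ∷ x₀ ∷ []))))
                    (lit 1 +ᵗ x₁ ∷ x₀ ∷ x₁ ∷ [])))
        (lit 1 +ᵗ x₀ ∷ x₀ ∷ [])

  offDiagonalNeqᵗ-sem : ∀ c → ⟦ offDiagonalNeqᵗ ⟧ (c ∷ []) ≡0⇔ OffDiagonalNeq c
  offDiagonalNeqᵗ-sem c = prodTo-≡0⇔-∃< (suc c) λ n → prodTo-≡0⇔-∃< (suc c) λ m →
    +-≡0⇔-× (1∸-≡0⇔-¬ (∸+∸-≡0⇔-≡ n m))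
            (≟ᵗ-sem x₂ (app neqCodeᵗ (x₁ ∷ x₀ ∷ [])) (m ∷ n ∷ c ∷ []) refl (neqCodeᵗ-sem n m))

  relCertᵗ : Term 2
  relCertᵗ =
    app (prodᵗ (app (prodᵗ body) (lit 1 +ᵗ x₁ ∷ x₀ ∷ x₁ ∷ x₂ ∷ []))) (lit 1 +ᵗ x₀ ∷ x₀ ∷ x₁ ∷ [])
    where
      entries : Term 4
      entries = app nthFreshᵗ (x₃ ∷ app entryᵗ (x₀ ∷ x₂ ∷ []) ∷ app entryᵗ (x₀ ∷ x₁ ∷ []) ∷ [])
      witness : Term 4
      witness =
        (x₃ ∋ᵗ app relCodeᵗ (x₂ ∷ x₀ ∷ [])) +ᵗ app (sumᵗ entries) (x₁ +ᵗ x₀ ∷ x₀ ∷ x₁ ∷ x₃ ∷ [])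
      body : Term 4
      body = (x₂ ≟ᵗ app relCodeᵗ (x₁ ∷ x₀ ∷ [])) +ᵗ app (prodᵗ witness) (x₃ ∷ x₀ ∷ x₁ ∷ x₃ ∷ [])

  relCertᵗ-sem : ∀ c u → ⟦ relCertᵗ ⟧ (c ∷ u ∷ []) ≡0⇔ RelCert c u
  relCertᵗ-sem c u = prodTo-≡0⇔-∃< (suc c) λ i → prodTo-≡0⇔-∃< (suc c) λ z →
    +-≡0⇔-× (≟ᵗ-sem x₂ (app relCodeᵗ (x₁ ∷ x₀ ∷ [])) (z ∷ i ∷ c ∷ u ∷ []) refl (relCodeᵗ-sem i z))
      (prodTo-≡0⇔-∃< u λ z' →
        +-≡0⇔-× (∋ᵗ-sem x₃ (app relCodeᵗ (x₂ ∷ x₀ ∷ [])) (z' ∷ z ∷ i ∷ u ∷ []) (relCodeᵗ-sem i z'))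
        (sumTo-≡0⇔-∀< (z + z') λ j →
          ≡0⇔-resp (cong₂ (λ s t → ⟦ nthFreshᵗ ⟧ (u ∷ s ∷ t ∷ [])) (entryᵗ-sem j z) (entryᵗ-sem j z'))
                   (nthFreshᵗ-sem u (entry j z) (entry j z'))))

  certifiesᵗ : Term 2
  certifiesᵗ = app (sumᵗ ((lit 1 ∸ᵗ (x₁ ∋ᵗ x₀)) *ᵗ app justifiedᵗ (x₀ ∷ x₂ ∷ []))) (x₀ ∷ x₀ ∷ x₁ ∷ [])
    where
      justifiedᵗ : Term 2
      justifiedᵗ = app diagonalEqᵗ (x₀ ∷ []) *ᵗ (app offDiagonalNeqᵗ (x₀ ∷ []) *ᵗ relCertᵗ)

  certifiesᵗ-sem : ∀ uB u → ⟦ certifiesᵗ ⟧ (uB ∷ u ∷ []) ≡0⇔ Certifies uB u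
  certifiesᵗ-sem uB u = sumTo-≡0⇔-∀< uB λ c →
    →-≡0⇔ (bit uB c ≟ 1) (∋ᵗ-sem x₁ x₀ (c ∷ uB ∷ u ∷ []) refl)
      (*-≡0⇔-⊎ (diagonalEqᵗ-sem c) (*-≡0⇔-⊎ (offDiagonalNeqᵗ-sem c) (relCertᵗ-sem c u)))

FinSubsetReduction : SetN → SetN → Set
FinSubsetReduction B C = Σ (PR 2) λ K →
  (∀ uB u → D u ⊆ C → eval K (uB ∷ u ∷ []) ≡ 0 → D uB ⊆ B) ×
  (∀ uB → D uB ⊆ B → ∃ λ u → D u ⊆ C × eval K (uB ∷ u ∷ []) ≡ 0)

module _ where

  open Terms
  open ArithmeticTerms
  open Pairing

  -- Search for ⟨uB, m⟩: m witnesses ⟨x, uB⟩ ∈ W_g, and K checks D uB against u.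
  composedᵗ : PR 2 → PR 2 → Term 2
  composedᵗ g K =
    app (prim g) (app pairᵗ (unpair₁ᵗ[ x₀ ] ∷ unpair₁ᵗ[ x₁ ] ∷ []) ∷ unpair₂ᵗ[ x₁ ] ∷ []) +ᵗ
    app (prim K) (unpair₁ᵗ[ x₁ ] ∷ unpair₂ᵗ[ x₀ ] ∷ [])
    where
      unpair₁ᵗ[_] unpair₂ᵗ[_] : Term 2 → Term 2
      unpair₁ᵗ[ t ] = app unpair₁ᵗ (t ∷ [])
      unpair₂ᵗ[ t ] = app unpair₂ᵗ (t ∷ [])

  composedᵗ-sem : ∀ g K x u m → eval (compile (composedᵗ g K)) (pair x u ∷ m ∷ []) ≡
    eval g (pair x (unpair₁ m) ∷ unpair₂ m ∷ []) + eval K (unpair₁ m ∷ u ∷ [])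
  composedᵗ-sem g K x u m
    rewrite eval-compile (composedᵗ g K) (pair x u ∷ m ∷ [])
          | unpair₁ᵗ-sem (pair x u) | unpair₁ᵗ-sem m | unpair₂ᵗ-sem (pair x u) | unpair₂ᵗ-sem m
          | unpair₁-pair x u | unpair₂-pair x u | pairᵗ-sem x (unpair₁ m) = refl

  ≤e-trans-FinSubset : ∀ {A B C} → A ≤e B → FinSubsetReduction B C → A ≤e C
  ≤e-trans-FinSubset {A} {B} {C} (g , A≤B) (K , K-sound , K-complete) =
    compile (composedᵗ g K) , λ x → mk⇔ (forward x) (backward x)
    where
      forward : ∀ x → A x → ∃ λ u → W (compile (composedᵗ g K)) (pair x u) × D u ⊆ C
      forward x a with to (A≤B x) a
      ... | uB , (mg , g≡0) , uB⊆B with K-complete uB uB⊆B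
      ...   | u , u⊆C , K≡0 = u , (pair uB mg , witness) , u⊆C
        where
          witness : eval (compile (composedᵗ g K)) (pair x u ∷ pair uB mg ∷ []) ≡ 0
          witness rewrite composedᵗ-sem g K x u (pair uB mg) | unpair₁-pair uB mg | unpair₂-pair uB mg
                        | g≡0 | K≡0 = refl
      backward : ∀ x → (∃ λ u → W (compile (composedᵗ g K)) (pair x u) × D u ⊆ C) → A x
      backward x (u , (m , ≡0) , u⊆C) =
        from (A≤B x) (unpair₁ m , (unpair₂ m , m+n≡0⇒m≡0 _ sum≡0) ,
                      K-sound (unpair₁ m) u u⊆C (m+n≡0⇒n≡0 _ sum≡0))
        where
          sum≡0 : eval g (pair x (unpair₁ m) ∷ unpair₂ m ∷ []) + eval K (unpair₁ m ∷ u ∷ []) ≡ 0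
          sum≡0 = trans (sym (composedᵗ-sem g K x u m)) ≡0

≤e-resp-≐ : ∀ {X S S' : SetN} → S ⊆ S' → S' ⊆ S → X ≤e S → X ≤e S'
≤e-resp-≐ S⊆S' S'⊆S (g , X≤S) = g , λ x → mk⇔
  (λ xx → let (u , w , u⊆S) = to (X≤S x) xx in u , w , λ i d → S⊆S' i (u⊆S i d))
  (λ (u , w , u⊆S') → from (X≤S x) (u , w , λ i d → S'⊆S i (u⊆S' i d)))

module _ {L : Language} {𝓐 𝓑 : Structure L} (iso : 𝓑 ≅ 𝓐) where

  open PresentationCodes L
  open ElementCodes

  private
    h : ℕ → ℕ
    h = proj₁ iso
    h-injective : Injective h
    h-injective = proj₁ (proj₂ iso)
    h-iso : ∀ i v → rel 𝓑 i v ⇔ rel 𝓐 i (map h v)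
    h-iso = proj₂ (proj₂ (proj₂ iso))

  P[h⁻¹𝓐]⊆P𝓑 : Pᵢ (preimage (proj₁ iso) 𝓐) ⊆ P 𝓑
  P[h⁻¹𝓐]⊆P𝓑 c p with viewP (preimage h 𝓐) p
  ... | eq-view  a b refl ha≡hb = eqCode⁺ (asInterp 𝓑) (h-injective a b ha≡hb)
  ... | neq-view a b refl ha≢hb = neqCode⁺ (asInterp 𝓑) (λ a≡b → ha≢hb (cong h a≡b))
  ... | rel-view i v refl r     = relCode⁺ (asInterp 𝓑) i (from (h-iso i v) r)

  P𝓑⊆P[h⁻¹𝓐] : P 𝓑 ⊆ Pᵢ (preimage (proj₁ iso) 𝓐)
  P𝓑⊆P[h⁻¹𝓐] c p with viewP (asInterp 𝓑) p
  ... | eq-view  a b refl a≡b = eqCode⁺ (preimage h 𝓐) (cong h a≡b)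
  ... | neq-view a b refl a≢b = neqCode⁺ (preimage h 𝓐) (λ ha≡hb → a≢b (h-injective a b ha≡hb))
  ... | rel-view i v refl r   = relCode⁺ (preimage h 𝓐) i (to (h-iso i v) r)

module Presentation (L : Language) (𝓐 : Structure L) (f : ℕ → ℕ) (f-surjective : Surjective f) where

  open PrimitiveRecursive using (sumTo; sumTo-cong; term≤sumTo)
  open Terms using (⟦_⟧; compile; eval-compile)
  open Pairing
  open BinaryDigits using (bit-bound; indicator; setCode; setCode-sound; setCode-complete)
  open ZeroTests
  open FirstOccurrences f f-surjective
  open ElementCodes
  open PresentationCodes L
  open Certificates

  𝓑 : Structure L
  𝓑 = record { rel = λ i v → rel 𝓐 i (map bijection v) }

  𝓑≅𝓐 : 𝓑 ≅ 𝓐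
  𝓑≅𝓐 = bijection , bijection-injective , bijection-surjective , λ i v → mk⇔ (λ r → r) (λ r → r)

  P[f⁻¹𝓐] : SetN
  P[f⁻¹𝓐] = Pᵢ (preimage f 𝓐)

  RichUpTo : ℕ → ℕ → Set
  RichUpTo u r = ∀ k j → k < j → j ≤ r →
    (f k ≢ f j → D u (neqCode k j)) × (f k ≡ f j → D u (eqCode k j))

  module _ {u : ℕ} (sound : D u ⊆ P[f⁻¹𝓐]) where

    FreshCert⇒Fresh : ∀ {j} → FreshCert u j → Fresh j
    FreshCert⇒Fresh cert (k , k<j , fk≡fj) = neqCode⁻ (preimage f 𝓐) (sound _ (cert k k<j)) fk≡fj

    RepeatCert⇒¬Fresh : ∀ {j} → RepeatCert u j → ¬ Fresh j
    RepeatCert⇒¬Fresh (k , k<j , b) fresh = fresh (k , k<j , eqCode⁻ (preimage f 𝓐) (sound _ b))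

    #freshCert≡#fresh : ∀ {r} → (∀ j → j < suc r → FreshCert u j ⊎ RepeatCert u j) → #freshCert u r ≡ #fresh r
    #freshCert≡#fresh {r} classified = sumTo-cong r (λ j j<r → pointwise j (classified j (m<n⇒m<1+n j<r)))
      where
        pointwise : ∀ j → FreshCert u j ⊎ RepeatCert u j → 1 ∸ ⟦ freshᵗ ⟧ (u ∷ j ∷ []) ≡ indicator (Fresh? j)
        pointwise j c with Fresh? j | c
        ... | yes _     | inj₁ fc = cong (1 ∸_) (from (freshᵗ-sem u j) fc)
        ... | no ¬fresh | inj₁ fc = ⊥-elim (¬fresh (FreshCert⇒Fresh fc))
        ... | yes fresh | inj₂ rc = ⊥-elim (RepeatCert⇒¬Fresh rc fresh)
        ... | no _      | inj₂ rc =
          from (1∸-≡0⇔-¬ (freshᵗ-sem u j)) (λ fc → RepeatCert⇒¬Fresh rc (FreshCert⇒Fresh fc))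

    NthFreshCert⇒NthFresh : ∀ {a r} → NthFreshCert u a r → NthFresh a r
    NthFreshCert⇒NthFresh (classified , fc , #≡a) =
      FreshCert⇒Fresh fc , trans (sym (#freshCert≡#fresh classified)) #≡a

    NthFresh⇒NthFreshCert : ∀ {a r} → RichUpTo u r → NthFresh a r → NthFreshCert u a r
    NthFresh⇒NthFreshCert {a} {r} rich (fresh , #≡a) =
      classified , certify r ≤-refl fresh , trans (#freshCert≡#fresh classified) #≡a
      where
        certify : ∀ j → j ≤ r → Fresh j → FreshCert u j
        certify j j≤r fj k k<j = proj₁ (rich k j k<j j≤r) (λ e → fj (k , k<j , e))
        classified : ∀ j → j < suc r → FreshCert u j ⊎ RepeatCert u j
        classified j (s≤s j≤r) with Fresh? j
        ... | yes fj = inj₁ (certify j j≤r fj)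
        ... | no ¬fj with ¬Fresh⇒repeat ¬fj
        ...   | k , k<j , e = inj₂ (k , k<j , proj₂ (rich k j k<j j≤r) e)

  entry-code-map-enum : ∀ {n} (v : Vec ℕ n) j → entry j (code (map enum v)) ≡ enum (entry j (code v))
  entry-code-map-enum []      j rewrite entry-0 j = refl
  entry-code-map-enum (x ∷ v) zero
    rewrite entry-zero-pair (enum x) (code (map enum v)) | entry-zero-pair x (code v) = refl
  entry-code-map-enum (x ∷ v) (suc j)
    rewrite entry-suc-pair j (enum x) (code (map enum v)) | entry-suc-pair j x (code v) =
    entry-code-map-enum v j

  pull-back : ∀ {n} (w : Vec ℕ n) z → (∀ j → NthFresh (entry j z) (entry j (code w))) →
              ∃ λ v → code v ≡ z × map enum v ≡ w
  pull-back [] z nth =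
    [] , entries-injective 0 z (λ j → trans (entry-0 j) (proj₂ (subst (NthFresh (entry j z)) (entry-0 j) (nth j)))) ,
    refl
  pull-back (x ∷ w) z nth
    with pull-back w (unpair₂ z) (λ j → subst (NthFresh (entry (suc j) z)) (entry-suc-pair j x (code w)) (nth (suc j)))
  ... | v , cv , mv =
    unpair₁ z ∷ v , trans (cong (pair (unpair₁ z)) cv) (pair-unpair z) ,
    cong₂ _∷_ (NthFresh⇒enum (subst (NthFresh (unpair₁ z)) (entry-zero-pair x (code w)) (nth 0))) mv

  entries : (n : ℕ) → ℕ → Vec ℕ n
  entries zero    c = []
  entries (suc n) c = unpair₁ c ∷ entries n (unpair₂ c)

  code-entries : ∀ n c → iterate unpair₂ c n ≡ 0 → code (entries n c) ≡ c
  code-entries zero    c e = sym e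
  code-entries (suc n) c e =
    trans (cong (pair (unpair₁ c)) (code-entries n (unpair₂ c) e)) (pair-unpair c)

  -- z entries suffice: all later entries of z are 0, and enum 0 = 0.
  enumCode : ℕ → ℕ
  enumCode z = code (map enum (entries z z))

  entry-enumCode : ∀ z j → entry j (enumCode z) ≡ enum (entry j z)
  entry-enumCode z j = trans (entry-code-map-enum (entries z z) j)
    (cong (λ t → enum (entry j t)) (code-entries z z (iterate-unpair₂-large z z ≤-refl)))

  code-map-enum : ∀ {n} (v : Vec ℕ n) {z} → code v ≡ z → code (map enum v) ≡ enumCode z
  code-map-enum v {z} refl = entries-injective _ _ (λ j →
    trans (entry-code-map-enum v j) (sym (entry-enumCode z j)))

  certified-sound : ∀ uB u → D u ⊆ P[f⁻¹𝓐] → Certifies uB u → D uB ⊆ P 𝓑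
  certified-sound uB u sound certifies c c∈uB with certifies c (bit-bound uB c c∈uB) c∈uB
  ... | inj₁ (n , _ , refl) = eqCode⁺ (asInterp 𝓑) {n} {n} refl
  ... | inj₂ (inj₁ (n , _ , m , _ , n≢m , refl)) = neqCode⁺ (asInterp 𝓑) n≢m
  ... | inj₂ (inj₂ (i , _ , z , _ , refl , z' , _ , z'∈u , nthCerts))
    with relCode⁻ (preimage f 𝓐) {i} {z'} (sound (relCode i z') z'∈u)
  ... | idx , refl , w , refl , r with pull-back w z nth
    where
      nth : ∀ j → NthFresh (entry j z) (entry j (code w))
      nth j with j <? z + code w
      ... | yes j<  = NthFreshCert⇒NthFresh sound (nthCerts j j<)
      ... | no  j≮ rewrite entry-large j z (≤-trans (m≤m+n z (code w)) (≮⇒≥ j≮))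
                         | entry-large j (code w) (≤-trans (m≤n+m (code w) z) (≮⇒≥ j≮)) = NthFresh-0-0
  ... | v , refl , refl = relCode⁺ (asInterp 𝓑) idx (subst (rel 𝓐 idx) (sym (map-∘ f enum v)) r)

  -- The certificate for D uB ⊆ P(𝓑): all true (in)equalities f a = f b with small codes, and the
  -- translation ⟨i, enumCode z⟩ of every ⟨i, z⟩ ∈ D uB; N bounds every code the check consults.
  module Completeness (uB : ℕ) (uB⊆P𝓑 : D uB ⊆ P 𝓑) where

    Fact : ℕ → Set
    Fact e = ∃ λ a → a < suc e × ∃ λ b → b < suc e ×
             ((e ≡ eqCode a b × f a ≡ f b) ⊎ (e ≡ neqCode a b × f a ≢ f b))

    Fact? : Decidable Fact
    Fact? e = anyUpTo? (λ a → anyUpTo? (λ b →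
      ((e ≟ eqCode a b) ×-dec (f a ≟ f b)) ⊎-dec ((e ≟ neqCode a b) ×-dec ¬? (f a ≟ f b)))
      (suc e)) (suc e)

    Translation : ℕ → Set
    Translation e = ∃ λ c → c < uB × (D uB c × ∃ λ i → i < suc c × ∃ λ z → z < suc c ×
                    (c ≡ relCode i z × e ≡ relCode i (enumCode z)))

    Translation? : Decidable Translation
    Translation? e = anyUpTo? (λ c → (bit uB c ≟ 1) ×-dec anyUpTo? (λ i → anyUpTo? (λ z →
      (c ≟ relCode i z) ×-dec (e ≟ relCode i (enumCode z))) (suc c)) (suc c)) uB

    InCertificate : ℕ → Set
    InCertificate e = Fact e ⊎ Translation e

    bound : ℕ → ℕ
    bound z = relCode uB (enumCode z) + neqCode (enumCode z) (enumCode z)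

    N : ℕ
    N = suc (sumTo uB bound)

    u : ℕ
    u = setCode (λ e → Fact? e ⊎-dec Translation? e) N

    u-sound : D u ⊆ P[f⁻¹𝓐]
    u-sound e e∈u with setCode-sound (λ e → Fact? e ⊎-dec Translation? e) N e e∈u
    ... | inj₁ (a , _ , b , _ , inj₁ (refl , fa≡fb)) = eqCode⁺ (preimage f 𝓐) fa≡fb
    ... | inj₁ (a , _ , b , _ , inj₂ (refl , fa≢fb)) = neqCode⁺ (preimage f 𝓐) fa≢fb
    ... | inj₂ (c , _ , c∈uB , i , _ , z , _ , refl , refl)
      with relCode⁻ (asInterp 𝓑) {i} {z} (uB⊆P𝓑 (relCode i z) c∈uB)
    ... | idx , refl , v , refl , r =
      subst (λ t → P[f⁻¹𝓐] (relCode (idxℕ L idx) t)) (code-map-enum v refl)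
        (relCode⁺ (preimage f 𝓐) idx (subst (rel 𝓐 idx) (map-∘ f enum v) r))

    u-complete : ∀ e → e < N → InCertificate e → D u e
    u-complete = setCode-complete (λ e → Fact? e ⊎-dec Translation? e) N

    bound<N : ∀ {z} → z < uB → bound z < N
    bound<N z<uB = s≤s (term≤sumTo uB bound z<uB)

    rich : ∀ {z r} → z < uB → r ≤ enumCode z → RichUpTo u r
    rich {z} z<uB r≤ k j k<j j≤r =
      (λ fk≢fj → u-complete (neqCode k j) neq<N
                   (inj₁ (k , s≤s (m≤neqCode k j) , j , s≤s (n≤neqCode k j) , inj₂ (refl , fk≢fj)))) ,
      (λ fk≡fj → u-complete (eqCode k j) (≤-<-trans (eqCode≤neqCode k j) neq<N)
                   (inj₁ (k , s≤s (m≤eqCode k j) , j , s≤s (n≤eqCode k j) , inj₁ (refl , fk≡fj))))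
      where
        j≤ : j ≤ enumCode z
        j≤ = ≤-trans j≤r r≤
        neq<N : neqCode k j < N
        neq<N = ≤-<-trans (neqCode-mono-≤ (≤-trans (<⇒≤ k<j) j≤) j≤)
                          (≤-<-trans (m≤n+m _ (relCode uB (enumCode z))) (bound<N z<uB))

    justified : ∀ {c} → c < uB → D uB c → PView (asInterp 𝓑) c → Justified c u
    justified _ _ (eq-view a .a refl refl) = inj₁ (a , s≤s (m≤eqCode a a) , refl)
    justified _ _ (neq-view a b refl a≢b) =
      inj₂ (inj₁ (a , s≤s (m≤neqCode a b) , b , s≤s (n≤neqCode a b) , a≢b , refl))
    justified c<uB c∈uB (rel-view idx v refl _) =
      inj₂ (inj₂ (i , s≤s (m≤relCode i z) , z , s≤s (n≤relCode i z) , refl , enumCode z ,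
                  ≤-<-trans (n≤relCode i (enumCode z)) (bit-bound u _ z'∈u) , z'∈u , λ j _ → nthCert j))
      where
        i z : ℕ
        i = idxℕ L idx
        z = code v
        z<uB : z < uB
        z<uB = ≤-<-trans (n≤relCode i z) c<uB
        z'<N : relCode i (enumCode z) < N
        z'<N = ≤-<-trans (relCode-monoˡ-≤ (enumCode z) (<⇒≤ (≤-<-trans (m≤relCode i z) c<uB)))
                         (≤-<-trans (m≤m+n _ (neqCode (enumCode z) (enumCode z))) (bound<N z<uB))
        z'∈u : D u (relCode i (enumCode z))
        z'∈u = u-complete _ z'<N
          (inj₂ (relCode i z , c<uB , c∈uB , i , s≤s (m≤relCode i z) , z , s≤s (n≤relCode i z) , refl , refl))
        nthCert : ∀ j → NthFreshCert u (entry j z) (entry j (enumCode z))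
        nthCert j = NthFresh⇒NthFreshCert u-sound (rich z<uB (entry-≤ j (enumCode z)))
          (subst (NthFresh (entry j z)) (sym (entry-enumCode z j)) (enum-NthFresh (entry j z)))

    u-certifies : Certifies uB u
    u-certifies c c<uB c∈uB = justified c<uB c∈uB (viewP (asInterp 𝓑) (uB⊆P𝓑 c c∈uB))

  certificate-exists : ∀ uB → D uB ⊆ P 𝓑 → ∃ λ u → D u ⊆ P[f⁻¹𝓐] × Certifies uB u
  certificate-exists uB uB⊆P𝓑 = u , u-sound , u-certifies
    where open Completeness uB uB⊆P𝓑

  P𝓑-FinSubset-P[f⁻¹𝓐] : FinSubsetReduction (P 𝓑) P[f⁻¹𝓐]
  P𝓑-FinSubset-P[f⁻¹𝓐] = compile certifiesᵗ ,
    (λ uB u u⊆ K≡0 → certified-sound uB u u⊆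
       (to (certifiesᵗ-sem uB u) (trans (sym (eval-compile certifiesᵗ (uB ∷ u ∷ []))) K≡0))) ,
    (λ uB uB⊆ → let (u , u⊆ , certifies) = certificate-exists uB uB⊆ in
       u , u⊆ , trans (eval-compile certifiesᵗ (uB ∷ u ∷ [])) (from (certifiesᵗ-sem uB u) certifies))

mainTheorem10 : (L : Language) (𝓐 : Structure L) (X : SetN) →
    (Co 𝓐 X → belowESp 𝓐 X) × (belowESp 𝓐 X → Co 𝓐 X)
mainTheorem10 L 𝓐 X = Co⇒belowESp , belowESp⇒Co
  where
    Co⇒belowESp : Co 𝓐 X → belowESp 𝓐 X
    Co⇒belowESp co f f-surjective = ≤e-trans-FinSubset (co 𝓑 𝓑≅𝓐) P𝓑-FinSubset-P[f⁻¹𝓐]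
      where open Presentation L 𝓐 f f-surjective
    belowESp⇒Co : belowESp 𝓐 X → Co 𝓐 X
    belowESp⇒Co below 𝓑 iso@(h , _ , h-surjective , _) =
      ≤e-resp-≐ (P[h⁻¹𝓐]⊆P𝓑 {𝓐 = 𝓐} iso) (P𝓑⊆P[h⁻¹𝓐] {𝓐 = 𝓐} iso) (below h h-surjective)
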